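{- For integers $d\ge1$, $q\ge2$ let $\delta=\lfloor d/2\rfloor$, $\delta'=\lceil d/2\rceil$, and for $\alpha\in[0,1)$ define \[ B^{\mathrm{SRW}}_{\alpha, d, q} = d + \tfrac{2(\delta q^{ -\delta} + \delta' q^{1-\delta'})}{q+1} + \tfrac{2(q^{1-\delta} - q^{1-\delta'})}{(q+1)^2},\qquad B^{\mathrm{sphere}}_{d,q} = d + \tfrac{ -4q+2(\delta'(q-1)+1)q^{1-\delta'} + 2(\delta(q-1)+q) q^{ -\delta}}{q^2-1}. \] Then: (1) for all $d\in\mathbb{Z}_{\ge1}$, $q\in\mathbb{Z}_{\ge2}$, $B^{\mathrm{sphere}}_{d,q}\ge 1$, with equality if and only if $d=1$; (2) $\inf\{B^{\mathrm{SRW}}_{\alpha,d,q}:\alpha\in[0,1), d\in\mathbb{Z}_{\ge1}, q\in\mathbb{Z}_{\ge2}\}=1$; (3) this infimum is not attained by any $\alpha,d,q$.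
   Formalization: The parameter α of $B^{\mathrm{SRW}}_{\alpha, d, q}$ ranges over the rationals in [0,1) instead of the reals. -}

module Defs where

open import Data.Nat as ℕ using (ℕ; zero; suc; ⌊_/2⌋; ⌈_/2⌉)
open import Data.Integer as ℤ using (+_)
open import Data.Rational using (ℚ; _/_; 0ℚ; _+_; _*_; _-_; -_)

ι : ℕ → ℚ
ι n = + n / 1

-- 1/n for n ≠ 0 (only ever applied to nonzero n under the hypotheses q ≥ 2);
-- the value at 0 is an irrelevant junk value.
recip : ℕ → ℚ
recip zero    = 0ℚ
recip (suc n) = + 1 / suc n

qpow⁻ : ℕ → ℕ → ℚ
qpow⁻ q k = recip (q ℕ.^ k)

-- B^SRW_{α,d,q}; the formula does not depend on α (kept as a parameter as in the paper)
-- δ = ⌊d/2⌋, δ' = ⌈d/2⌉, and q^{1-k} = q · q^{-k}.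
BSRW : ℚ → ℕ → ℕ → ℚ
BSRW α d q =
  ι d
  + (ι 2 * (ι δ * qpow⁻ q δ + ι δ' * (ι q * qpow⁻ q δ'))) * recip (q ℕ.+ 1)
  + (ι 2 * (ι q * qpow⁻ q δ - ι q * qpow⁻ q δ')) * recip ((q ℕ.+ 1) ℕ.^ 2)
  where
  δ  = ⌊ d /2⌋
  δ' = ⌈ d /2⌉

Bsphere : ℕ → ℕ → ℚ
Bsphere d q =
  ι d
  + ( - (ι 4 * ι q)
      + ι 2 * (ι δ' * ι (q ℕ.∸ 1) + ι 1) * (ι q * qpow⁻ q δ')
      + ι 2 * (ι δ * ι (q ℕ.∸ 1) + ι q) * qpow⁻ q δ )
    * recip (q ℕ.^ 2 ℕ.∸ 1)
  where
  δ  = ⌊ d /2⌋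
  δ' = ⌈ d /2⌉

module Submission where

open import Defs
open import Data.Nat as ℕ using (ℕ; zero; suc; NonZero; ⌊_/2⌋; ⌈_/2⌉; z≤n; s≤s)
import Data.Nat.Properties as ℕP
open import Data.Nat.Tactic.RingSolver using (solve)
open import Data.Integer as ℤ using (+_; +[1+_]; -[1+_])
import Data.Integer.Properties as ℤP
open import Data.Rational hiding (_÷_; NonZero)
open import Data.Rational.Properties
open import Data.Rational.Unnormalised using (mkℚᵘ; *≡*; *≤*; *<*) renaming (_≃_ to _≃ᵘ_)
import Data.Rational.Unnormalised.Properties as ℚᵘP
open import Data.Rational.Solver using (module +-*-Solver)
open import Data.Empty using (⊥-elim)
open import Data.List using (_∷_; [])
open import Data.Product using (_×_; ∃-syntax; _,_)
open import Function.Bundles using (_⇔_; mk⇔)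
open import Relation.Binary.PropositionalEquality

-- B^SRW is d plus two correction terms, the first positive (δ' ≥ 1) and the second
-- nonnegative (q^{-δ'} ≤ q^{-δ}); hence it exceeds d ≥ 1, so 1 is a lower bound that is
-- never attained. At d = 1 it equals 1 + 2/(q+1) + 2(q-1)/(q+1)² < 1 + 4/(q+1), which is
-- below 1 + ε for q large, so 1 is the infimum.
-- B^sphere is d + (A + B - 4q)/(q² - 1) with A, B ≥ 0. For d = 1 we have A = B = 2q and
-- the value is exactly 1. For d ≥ 2 it exceeds 1 as soon as 4q < (d - 1)(q² - 1) + A + B:
-- for d = 2 use A = 2q and B ≥ 2 (the gap is (q - 1)²), for d = 3 use A, B ≥ 2, and for
-- d ≥ 4 already 4q < 3(q² - 1).

infixl 7 _÷_

_÷_ : ℕ → ℕ → ℚ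
a ÷ m = ι a * recip m

toℚᵘ-ι : ∀ a → toℚᵘ (ι a) ≃ᵘ mkℚᵘ (+ a) 0
toℚᵘ-ι a = toℚᵘ-fromℚᵘ (mkℚᵘ (+ a) 0)

toℚᵘ-÷ : ∀ a m → toℚᵘ (a ÷ suc m) ≃ᵘ mkℚᵘ (+ a) m
toℚᵘ-÷ a m = ℚᵘP.≃-trans (toℚᵘ-homo-* (ι a) (recip (suc m)))
  (ℚᵘP.≃-trans (ℚᵘP.*-cong (toℚᵘ-ι a) (toℚᵘ-fromℚᵘ (mkℚᵘ (+ 1) m)))
    (*≡* (cong₂ ℤ._*_ (ℤP.*-identityʳ (+ a)) (cong (λ n → + suc n) (sym (ℕP.+-identityʳ m))))))

÷≤÷ : ∀ a b m n .{{_ : NonZero m}} .{{_ : NonZero n}} → a ℕ.* n ℕ.≤ b ℕ.* m → a ÷ m ≤ b ÷ n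
÷≤÷ a b (suc m) (suc n) an≤bm = toℚᵘ-cancel-≤
  (ℚᵘP.≤-respˡ-≃ (ℚᵘP.≃-sym (toℚᵘ-÷ a m)) (ℚᵘP.≤-respʳ-≃ (ℚᵘP.≃-sym (toℚᵘ-÷ b n))
    (*≤* (subst₂ ℤ._≤_ (ℤP.pos-* a (suc n)) (ℤP.pos-* b (suc m)) (ℤ.+≤+ an≤bm)))))

÷<÷ : ∀ a b m n .{{_ : NonZero m}} .{{_ : NonZero n}} → a ℕ.* n ℕ.< b ℕ.* m → a ÷ m < b ÷ n
÷<÷ a b (suc m) (suc n) an<bm = toℚᵘ-cancel-<
  (ℚᵘP.<-respˡ-≃ (ℚᵘP.≃-sym (toℚᵘ-÷ a m)) (ℚᵘP.<-respʳ-≃ (ℚᵘP.≃-sym (toℚᵘ-÷ b n))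
    (*<* (subst₂ ℤ._<_ (ℤP.pos-* a (suc n)) (ℤP.pos-* b (suc m)) (ℤ.+<+ an<bm)))))

÷≡÷ : ∀ a b m n .{{_ : NonZero m}} .{{_ : NonZero n}} → a ℕ.* n ≡ b ℕ.* m → a ÷ m ≡ b ÷ n
÷≡÷ a b m n an≡bm =
  ≤-antisym (÷≤÷ a b m n (ℕP.≤-reflexive an≡bm)) (÷≤÷ b a n m (ℕP.≤-reflexive (sym an≡bm)))

/≡÷ : ∀ a m → + a / suc m ≡ a ÷ suc m
/≡÷ a m = toℚᵘ-injective (ℚᵘP.≃-trans (toℚᵘ-fromℚᵘ (mkℚᵘ (+ a) m)) (ℚᵘP.≃-sym (toℚᵘ-÷ a m)))

÷1≡ι : ∀ a → a ÷ 1 ≡ ι a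
÷1≡ι a = *-identityʳ (ι a)

ι≤÷ : ∀ c a m .{{_ : NonZero m}} → c ℕ.* m ℕ.≤ a → ι c ≤ a ÷ m
ι≤÷ c a m cm≤a =
  subst (_≤ a ÷ m) (÷1≡ι c) (÷≤÷ c a 1 m (subst (c ℕ.* m ℕ.≤_) (sym (ℕP.*-identityʳ a)) cm≤a))

÷≡ι : ∀ a c m .{{_ : NonZero m}} → a ≡ c ℕ.* m → a ÷ m ≡ ι c
÷≡ι a c m a≡cm = trans (÷≡÷ a c m 1 (trans (ℕP.*-identityʳ a) a≡cm)) (÷1≡ι c)

÷-self : ∀ m .{{_ : NonZero m}} → m ÷ m ≡ 1ℚ
÷-self m = ÷≡ι m 1 m (sym (ℕP.*-identityˡ m))

÷-nonNeg : ∀ a m .{{_ : NonZero m}} → 0ℚ ≤ a ÷ m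
÷-nonNeg a m = ι≤÷ 0 a m z≤n

÷-pos : ∀ a m .{{_ : NonZero a}} .{{_ : NonZero m}} → 0ℚ < a ÷ m
÷-pos a m = ÷<÷ 0 a 1 m (ℕ.>-nonZero⁻¹ (a ℕ.* 1) {{ℕP.m*n≢0 a 1}})

recip-pos : ∀ m .{{_ : NonZero m}} → 0ℚ < recip m
recip-pos m = subst (0ℚ <_) (*-identityˡ (recip m)) (÷-pos 1 m)

ι-mono-≤ : ∀ {a b} → a ℕ.≤ b → ι a ≤ ι b
ι-mono-≤ {a} {b} a≤b = subst₂ _≤_ (÷1≡ι a) (÷1≡ι b) (÷≤÷ a b 1 1 (ℕP.*-monoˡ-≤ 1 a≤b))

ι-mono-< : ∀ {a b} → a ℕ.< b → ι a < ι b
ι-mono-< {a} {b} a<b = subst₂ _<_ (÷1≡ι a) (÷1≡ι b) (÷<÷ a b 1 1 (ℕP.*-monoˡ-< 1 a<b))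

ι-+ : ∀ a b → ι (a ℕ.+ b) ≡ ι a + ι b
ι-+ a b = toℚᵘ-injective (ℚᵘP.≃-trans (toℚᵘ-ι (a ℕ.+ b))
  (ℚᵘP.≃-trans (*≡* (cong (ℤ._* + 1) (trans (ℤP.pos-+ a b)
                     (sym (cong₂ ℤ._+_ (ℤP.*-identityʳ (+ a)) (ℤP.*-identityʳ (+ b)))))))
    (ℚᵘP.≃-sym (ℚᵘP.≃-trans (toℚᵘ-homo-+ (ι a) (ι b)) (ℚᵘP.+-cong (toℚᵘ-ι a) (toℚᵘ-ι b))))))

ι-* : ∀ a b → ι (a ℕ.* b) ≡ ι a * ι b
ι-* a b = toℚᵘ-injective (ℚᵘP.≃-trans (toℚᵘ-ι (a ℕ.* b))
  (ℚᵘP.≃-trans (*≡* (cong (ℤ._* + 1) (ℤP.pos-* a b)))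
    (ℚᵘP.≃-sym (ℚᵘP.≃-trans (toℚᵘ-homo-* (ι a) (ι b)) (ℚᵘP.*-cong (toℚᵘ-ι a) (toℚᵘ-ι b))))))

ι-*+ : ∀ a b c → ι (a ℕ.* b ℕ.+ c) ≡ ι a * ι b + ι c
ι-*+ a b c = trans (ι-+ (a ℕ.* b) c) (cong (_+ ι c) (ι-* a b))

m+k≡n⇒m≤n : ∀ {m n} k → m ℕ.+ k ≡ n → m ℕ.≤ n
m+k≡n⇒m≤n {m} k refl = ℕP.m≤m+n m k

p<p+q : ∀ p {q} → 0ℚ < q → p < p + q
p<p+q p 0<q = subst (_< p + _) (+-identityʳ p) (+-monoʳ-< p 0<q)

p≤p+q : ∀ p {q} → 0ℚ ≤ q → p ≤ p + q
p≤p+q p 0≤q = subst (_≤ p + _) (+-identityʳ p) (+-monoʳ-≤ p 0≤q)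

p≤q⇒0≤q-p : ∀ {p q} → p ≤ q → 0ℚ ≤ q - p
p≤q⇒0≤q-p {p} {q} p≤q = subst (_≤ q - p) (+-inverseʳ p) (+-monoˡ-≤ (- p) p≤q)

p<q⇒0<q-p : ∀ {p q} → p < q → 0ℚ < q - p
p<q⇒0<q-p {p} {q} p<q = subst (_< q - p) (+-inverseʳ p) (+-monoˡ-< (- p) p<q)

p-q≤p : ∀ p {q} → 0ℚ ≤ q → p - q ≤ p
p-q≤p p 0≤q = subst (p - _ ≤_) (+-identityʳ p) (+-monoʳ-≤ p (neg-antimono-≤ 0≤q))

*-pos : ∀ {p q} → 0ℚ < p → 0ℚ < q → 0ℚ < p * q
*-pos {p} {q} 0<p 0<q = positive⁻¹ (p * q) {{pos*pos⇒pos p {{positive 0<p}} q {{positive 0<q}}}}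

*-nonNeg : ∀ {p q} → 0ℚ ≤ p → 0ℚ ≤ q → 0ℚ ≤ p * q
*-nonNeg {p} {q} 0≤p 0≤q =
  nonNegative⁻¹ (p * q) {{nonNeg*nonNeg⇒nonNeg p {{nonNegative 0≤p}} q {{nonNegative 0≤q}}}}

1<BSRW : ∀ α d q → 1 ℕ.≤ d → 1 ℕ.≤ q → 1ℚ < BSRW α d q
1<BSRW α d@(suc _) q@(suc _) 1≤d _ = begin-strict
  1ℚ                   ≤⟨ ι-mono-≤ 1≤d ⟩
  ι d                  <⟨ p<p+q (ι d) (*-pos 0<X (recip-pos (q ℕ.+ 1))) ⟩
  ι d + X * r          ≤⟨ p≤p+q (ι d + X * r) (*-nonNeg 0≤Y (<⇒≤ (recip-pos ((q ℕ.+ 1) ℕ.^ 2)))) ⟩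
  ι d + X * r + Y * r² ∎
  where
  open ≤-Reasoning
  δ  = ⌊ d /2⌋
  δ' = ⌈ d /2⌉
  r  = recip (q ℕ.+ 1)
  r² = recip ((q ℕ.+ 1) ℕ.^ 2)
  instance
    q^δ≢0 : NonZero (q ℕ.^ δ)
    q^δ≢0 = ℕP.m^n≢0 q δ
    q^δ'≢0 : NonZero (q ℕ.^ δ')
    q^δ'≢0 = ℕP.m^n≢0 q δ'
  X = ι 2 * (δ ÷ q ℕ.^ δ + ι δ' * (q ÷ q ℕ.^ δ'))
  Y = ι 2 * (q ÷ q ℕ.^ δ - q ÷ q ℕ.^ δ')
  0<X : 0ℚ < X
  0<X = *-pos (ι-mono-< {b = 2} (s≤s z≤n))
    (+-mono-≤-< (÷-nonNeg δ (q ℕ.^ δ)) (*-pos (ι-mono-< {b = δ'} (s≤s z≤n)) (÷-pos q (q ℕ.^ δ'))))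
  0≤Y : 0ℚ ≤ Y
  0≤Y = *-nonNeg (ι-mono-≤ {b = 2} z≤n) (p≤q⇒0≤q-p
    (÷≤÷ q q (q ℕ.^ δ') (q ℕ.^ δ) (ℕP.*-monoʳ-≤ q (ℕP.^-monoʳ-≤ q (ℕP.⌊n/2⌋≤⌈n/2⌉ d)))))

BSRW-1≤1+4÷[1+q] : ∀ α q .{{_ : NonZero q}} → BSRW α 1 q ≤ 1ℚ + 4 ÷ suc q
BSRW-1≤1+4÷[1+q] α q = begin
  ι 1 + ι 2 * (0 ÷ 1 + ι 1 * (q ÷ q ℕ.^ 1)) * r + ι 2 * (q ÷ 1 - q ÷ q ℕ.^ 1) * r²
    ≡⟨ cong (λ x → ι 1 + ι 2 * (0 ÷ 1 + ι 1 * x) * r + ι 2 * (q ÷ 1 - x) * r²) q÷q≡1 ⟩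
  1ℚ + 2 ÷ (q ℕ.+ 1) + ι 2 * (q ÷ 1 - 1ℚ) * r²
    ≤⟨ +-monoʳ-≤ (1ℚ + 2 ÷ (q ℕ.+ 1)) tail≤ ⟩
  1ℚ + 2 ÷ (q ℕ.+ 1) + 2 ÷ (q ℕ.+ 1)
    ≡⟨ +-assoc 1ℚ (2 ÷ (q ℕ.+ 1)) (2 ÷ (q ℕ.+ 1)) ⟩
  1ℚ + (2 ÷ (q ℕ.+ 1) + 2 ÷ (q ℕ.+ 1))
    ≡⟨ cong (λ x → 1ℚ + x)
         (trans (sym (*-distribʳ-+ r (ι 2) (ι 2))) (cong (λ m → ι 4 * recip m) (ℕP.+-comm q 1))) ⟩
  1ℚ + 4 ÷ suc q ∎
  where
  open ≤-Reasoning
  r  = recip (q ℕ.+ 1)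
  r² = recip ((q ℕ.+ 1) ℕ.^ 2)
  instance
    q+1≢0 : NonZero (q ℕ.+ 1)
    q+1≢0 = subst NonZero (ℕP.+-comm 1 q) _
    [q+1]²≢0 : NonZero ((q ℕ.+ 1) ℕ.^ 2)
    [q+1]²≢0 = ℕP.m^n≢0 (q ℕ.+ 1) 2
    q¹≢0 : NonZero (q ℕ.^ 1)
    q¹≢0 = ℕP.m^n≢0 q 1
  q÷q≡1 : q ÷ q ℕ.^ 1 ≡ 1ℚ
  q÷q≡1 = ÷≡ι q 1 (q ℕ.^ 1) (sym (trans (ℕP.*-identityˡ _) (ℕP.^-identityʳ q)))
  tail≤ : ι 2 * (q ÷ 1 - 1ℚ) * r² ≤ 2 ÷ (q ℕ.+ 1)
  tail≤ = begin
    ι 2 * (q ÷ 1 - 1ℚ) * r²  ≤⟨ *-monoʳ-≤-nonNeg r² {{nonNegative (<⇒≤ (recip-pos ((q ℕ.+ 1) ℕ.^ 2)))}}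
                                 (*-monoˡ-≤-nonNeg (ι 2) (p-q≤p (q ÷ 1) (<⇒≤ (positive⁻¹ 1ℚ)))) ⟩
    ι 2 * (q ÷ 1) * r²       ≡⟨ cong (λ x → ι 2 * x * r²) (÷1≡ι q) ⟩
    ι 2 * ι q * r²           ≡⟨ cong (_* r²) (sym (ι-* 2 q)) ⟩
    (2 ℕ.* q) ÷ (q ℕ.+ 1) ℕ.^ 2
      ≤⟨ ÷≤÷ (2 ℕ.* q) 2 ((q ℕ.+ 1) ℕ.* ((q ℕ.+ 1) ℕ.* 1)) (q ℕ.+ 1)
           (m+k≡n⇒m≤n (2 ℕ.* (q ℕ.+ 1)) (solve (q ∷ []))) ⟩
    2 ÷ (q ℕ.+ 1) ∎

÷-archimedean : ∀ k ε → 0ℚ < ε → k ÷ suc (k ℕ.* ↧ₙ ε) < ε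
÷-archimedean k ε@(mkℚ +[1+ n ] m _) _ = subst (k ÷ suc (k ℕ.* suc m) <_) ε≡÷
  (÷<÷ k (suc n) (suc (k ℕ.* suc m)) (suc m) (ℕP.m≤m+n (suc (k ℕ.* suc m)) (n ℕ.* suc (k ℕ.* suc m))))
  where
  ε≡÷ : suc n ÷ suc m ≡ ε
  ε≡÷ = trans (sym (/≡÷ (suc n) m)) (↥p/↧p≡p ε)
÷-archimedean k (mkℚ (+ zero) _ _) (*<* (ℤ.+<+ ()))
÷-archimedean k (mkℚ -[1+ _ ] _ _) (*<* ())

BSRW-approaches-1 : ∀ ε → 0ℚ < ε →
  ∃[ α ] ∃[ d ] ∃[ q ] (0ℚ ≤ α × α < 1ℚ × 1 ℕ.≤ d × 2 ℕ.≤ q × BSRW α d q < 1ℚ + ε)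
BSRW-approaches-1 ε 0<ε = 0ℚ , 1 , q , ≤-refl , positive⁻¹ 1ℚ , s≤s z≤n , 2≤q ,
  ≤-<-trans (BSRW-1≤1+4÷[1+q] 0ℚ q) (+-monoʳ-< 1ℚ (÷-archimedean 4 ε 0<ε))
  where
  q = 4 ℕ.* ↧ₙ ε
  2≤q : 2 ℕ.≤ q
  2≤q = ℕP.≤-trans (s≤s (s≤s z≤n)) (ℕP.m≤m*n 4 (↧ₙ ε))

-- The numerator terms A and B: Bsphere d q unfolds to
-- ι d + (- (ι 4 * ι q) + sphereA ⌈ d /2⌉ q + sphereB ⌊ d /2⌋ q) * recip (q ℕ.^ 2 ℕ.∸ 1).
sphereA sphereB : ℕ → ℕ → ℚ
sphereA k q = ι 2 * (ι k * ι (q ℕ.∸ 1) + ι 1) * (ι q * qpow⁻ q k)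
sphereB k q = ι 2 * (ι k * ι (q ℕ.∸ 1) + ι q) * qpow⁻ q k

sphereA-÷ : ∀ k q → sphereA k q ≡ (2 ℕ.* (k ℕ.* (q ℕ.∸ 1) ℕ.+ 1) ℕ.* q) ÷ q ℕ.^ k
sphereA-÷ k q = begin
  ι 2 * (ι k * ι p + ι 1) * (ι q * r) ≡⟨ cong (λ x → ι 2 * x * (ι q * r)) (sym (ι-*+ k p 1)) ⟩
  ι 2 * ι s * (ι q * r)               ≡⟨ sym (*-assoc (ι 2 * ι s) (ι q) r) ⟩
  ι 2 * ι s * ι q * r
    ≡⟨ cong (_* r) (sym (trans (ι-* (2 ℕ.* s) q) (cong (_* ι q) (ι-* 2 s)))) ⟩
  ι (2 ℕ.* s ℕ.* q) * r               ∎
  where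
  open ≡-Reasoning
  p = q ℕ.∸ 1
  s = k ℕ.* p ℕ.+ 1
  r = qpow⁻ q k

sphereB-÷ : ∀ k q → sphereB k q ≡ (2 ℕ.* (k ℕ.* (q ℕ.∸ 1) ℕ.+ q)) ÷ q ℕ.^ k
sphereB-÷ k q = cong (_* qpow⁻ q k)
  (sym (trans (ι-* 2 (k ℕ.* (q ℕ.∸ 1) ℕ.+ q)) (cong (ι 2 *_) (ι-*+ k (q ℕ.∸ 1) q))))

sphereA-1 : ∀ q .{{_ : NonZero q}} → sphereA 1 q ≡ ι 2 * ι q
sphereA-1 q@(suc p) = trans (sphereA-÷ 1 q)
  (trans (÷≡ι (2 ℕ.* (1 ℕ.* p ℕ.+ 1) ℕ.* q) (2 ℕ.* q) (q ℕ.* 1) (solve (p ∷ []))) (ι-* 2 q))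

sphereB-0 : ∀ q → sphereB 0 q ≡ ι 2 * ι q
sphereB-0 q = trans (sphereB-÷ 0 q) (trans (÷1≡ι (2 ℕ.* q)) (ι-* 2 q))

2≤sphereA-2 : ∀ q .{{_ : NonZero q}} → ι 2 ≤ sphereA 2 q
2≤sphereA-2 q@(suc p) = subst (ι 2 ≤_) (sym (sphereA-÷ 2 q))
  (ι≤÷ 2 (2 ℕ.* (2 ℕ.* p ℕ.+ 1) ℕ.* q) (q ℕ.* (q ℕ.* 1)) {{ℕP.m^n≢0 q 2}}
    (m+k≡n⇒m≤n (2 ℕ.* p ℕ.* q) (solve (p ∷ []))))

2≤sphereB-1 : ∀ q .{{_ : NonZero q}} → ι 2 ≤ sphereB 1 q
2≤sphereB-1 q@(suc p) = subst (ι 2 ≤_) (sym (sphereB-÷ 1 q))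
  (ι≤÷ 2 (2 ℕ.* (1 ℕ.* p ℕ.+ q)) (q ℕ.* 1) (m+k≡n⇒m≤n (2 ℕ.* p) (solve (p ∷ []))))

0≤sphereA : ∀ k q .{{_ : NonZero q}} → 0ℚ ≤ sphereA k q
0≤sphereA k q = subst (0ℚ ≤_) (sym (sphereA-÷ k q))
  (÷-nonNeg (2 ℕ.* (k ℕ.* (q ℕ.∸ 1) ℕ.+ 1) ℕ.* q) (q ℕ.^ k) {{ℕP.m^n≢0 q k}})

0≤sphereB : ∀ k q .{{_ : NonZero q}} → 0ℚ ≤ sphereB k q
0≤sphereB k q = subst (0ℚ ≤_) (sym (sphereB-÷ k q))
  (÷-nonNeg (2 ℕ.* (k ℕ.* (q ℕ.∸ 1) ℕ.+ q)) (q ℕ.^ k) {{ℕP.m^n≢0 q k}})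

1<1+e+[A+B-4q]/m : ∀ e c q m .{{_ : NonZero m}} {A B} →
  4 ℕ.* q ℕ.< e ℕ.* m ℕ.+ c → ι c ≤ A + B →
  1ℚ < ι (suc e) + (- (ι 4 * ι q) + A + B) * recip m
1<1+e+[A+B-4q]/m e c q m {A} {B} 4q<em+c c≤A+B = begin-strict
  1ℚ                            <⟨ p<p+q 1ℚ (*-pos (p<q⇒0<q-p (ι-mono-< 4q<em+c)) (recip-pos m)) ⟩
  1ℚ + (ι (e ℕ.* m ℕ.+ c) - K) * r ≡⟨ regroup ⟩
  ι (suc e) + (- K + ι c) * r   ≤⟨ +-monoʳ-≤ (ι (suc e))
                                     (*-monoʳ-≤-nonNeg r {{nonNegative (<⇒≤ (recip-pos m))}}
                                       (+-monoʳ-≤ (- K) c≤A+B)) ⟩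
  ι (suc e) + (- K + (A + B)) * r ≡⟨ cong (λ x → ι (suc e) + x * r)
                                       (trans (sym (+-assoc (- K) A B)) (cong (λ x → - x + A + B) (ι-* 4 q))) ⟩
  ι (suc e) + (- (ι 4 * ι q) + A + B) * r ∎
  where
  open ≤-Reasoning
  K = ι (4 ℕ.* q)
  r = recip m
  regroup : 1ℚ + (ι (e ℕ.* m ℕ.+ c) - K) * r ≡ ι (suc e) + (- K + ι c) * r
  regroup = begin-equality
    1ℚ + (ι (e ℕ.* m ℕ.+ c) - K) * r   ≡⟨ cong (λ x → 1ℚ + (x - K) * r) (ι-*+ e m c) ⟩
    1ℚ + (ι e * ι m + ι c - K) * r     ≡⟨ solveℚ 5 (λ E M C K r → con 1ℚ :+ (E :* M :+ C :- K) :* r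
                                                   := con 1ℚ :+ E :* (M :* r) :+ (:- K :+ C) :* r)
                                                 refl (ι e) (ι m) (ι c) K r ⟩
    1ℚ + ι e * (m ÷ m) + (- K + ι c) * r ≡⟨ cong (λ x → 1ℚ + ι e * x + (- K + ι c) * r) (÷-self m) ⟩
    1ℚ + ι e * 1ℚ + (- K + ι c) * r    ≡⟨ cong (λ x → 1ℚ + x + (- K + ι c) * r) (*-identityʳ (ι e)) ⟩
    1ℚ + ι e + (- K + ι c) * r         ≡⟨ cong (_+ (- K + ι c) * r) (sym (ι-+ 1 e)) ⟩
    ι (suc e) + (- K + ι c) * r        ∎
    where open +-*-Solver renaming (solve to solveℚ)

sq∸1 : ∀ p → suc p ℕ.^ 2 ℕ.∸ 1 ≡ p ℕ.* (2 ℕ.+ p)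
sq∸1 p = unfolded
  where
  -- the normal form of the left-hand side; the solver sees through neither _^_ nor _∸_
  unfolded : p ℕ.* 1 ℕ.+ p ℕ.* suc (p ℕ.* 1) ≡ p ℕ.* (2 ℕ.+ p)
  unfolded = solve (p ∷ [])

Bsphere-1 : ∀ q .{{_ : NonZero q}} → Bsphere 1 q ≡ 1ℚ
Bsphere-1 q = begin
  ι 1 + (- (ι 4 * ι q) + sphereA 1 q + sphereB 0 q) * r
    ≡⟨ cong₂ (λ a b → ι 1 + (- (ι 4 * ι q) + a + b) * r) (sphereA-1 q) (sphereB-0 q) ⟩
  ι 1 + (- (ι 4 * ι q) + ι 2 * ι q + ι 2 * ι q) * r
    ≡⟨ solveℚ 3 (λ T Q r → con 1ℚ :+ (:- ((T :+ T) :* Q) :+ T :* Q :+ T :* Q) :* r := con 1ℚ)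
               refl (ι 2) (ι q) r ⟩
  1ℚ ∎
  where
  open ≡-Reasoning
  open +-*-Solver renaming (solve to solveℚ)
  r = recip (q ℕ.^ 2 ℕ.∸ 1)

1<Bsphere : ∀ e q → 2 ℕ.≤ q → 1ℚ < Bsphere (2 ℕ.+ e) q
1<Bsphere _ (suc zero) (s≤s ())
1<Bsphere zero q@(suc p@(suc t)) _ = 1<1+e+[A+B-4q]/m 1 (2 ℕ.* q ℕ.+ 2) q (q ℕ.^ 2 ℕ.∸ 1)
  (subst (λ m → 4 ℕ.* q ℕ.< 1 ℕ.* m ℕ.+ (2 ℕ.* q ℕ.+ 2)) (sym (sq∸1 p))
    (m+k≡n⇒m≤n (2 ℕ.* t ℕ.+ t ℕ.* t) (solve (t ∷ []))))
  (subst (_≤ sphereA 1 q + sphereB 1 q) (sym (trans (ι-+ (2 ℕ.* q) 2) (cong (_+ ι 2) (ι-* 2 q))))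
    (+-mono-≤ (≤-reflexive (sym (sphereA-1 q))) (2≤sphereB-1 q)))
1<Bsphere (suc zero) q@(suc p@(suc t)) _ = 1<1+e+[A+B-4q]/m 2 4 q (q ℕ.^ 2 ℕ.∸ 1)
  (subst (λ m → 4 ℕ.* q ℕ.< 2 ℕ.* m ℕ.+ 4) (sym (sq∸1 p))
    (m+k≡n⇒m≤n (1 ℕ.+ 4 ℕ.* t ℕ.+ 2 ℕ.* (t ℕ.* t)) (solve (t ∷ []))))
  (+-mono-≤ (2≤sphereA-2 q) (2≤sphereB-1 q))
1<Bsphere (suc (suc e)) q@(suc p@(suc t)) _ = 1<1+e+[A+B-4q]/m (3 ℕ.+ e) 0 q (q ℕ.^ 2 ℕ.∸ 1)
  (subst (λ m → 4 ℕ.* q ℕ.< (3 ℕ.+ e) ℕ.* m ℕ.+ 0) (sym (sq∸1 p))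
    (m+k≡n⇒m≤n (8 ℕ.* t ℕ.+ 3 ℕ.* (t ℕ.* t) ℕ.+ e ℕ.* (suc t ℕ.* (3 ℕ.+ t))) (solve (t ∷ e ∷ []))))
  (+-mono-≤ (0≤sphereA ⌈ 4 ℕ.+ e /2⌉ q) (0≤sphereB ⌊ 4 ℕ.+ e /2⌋ q))

proposition9p3 :
    ((d q : ℕ) → 1 ℕ.≤ d → 2 ℕ.≤ q →
       (1ℚ ≤ Bsphere d q) × (Bsphere d q ≡ 1ℚ ⇔ d ≡ 1))
    × (((α : ℚ) (d q : ℕ) → 0ℚ ≤ α → α < 1ℚ → 1 ℕ.≤ d → 2 ℕ.≤ q → 1ℚ ≤ BSRW α d q)
       × ((ε : ℚ) → 0ℚ < ε →
            ∃[ α ] ∃[ d ] ∃[ q ] (0ℚ ≤ α × α < 1ℚ × 1 ℕ.≤ d × 2 ℕ.≤ q × BSRW α d q < 1ℚ + ε)))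
    × ((α : ℚ) (d q : ℕ) → 0ℚ ≤ α → α < 1ℚ → 1 ℕ.≤ d → 2 ℕ.≤ q → BSRW α d q ≢ 1ℚ)
proposition9p3 =
  sphere ,
  ((λ α d q _ _ 1≤d 2≤q → <⇒≤ (1<BSRW α d q 1≤d (ℕP.<⇒≤ 2≤q))) , BSRW-approaches-1) ,
  (λ α d q _ _ 1≤d 2≤q → ≢-sym (<⇒≢ (1<BSRW α d q 1≤d (ℕP.<⇒≤ 2≤q))))
  where
  sphere : (d q : ℕ) → 1 ℕ.≤ d → 2 ℕ.≤ q → (1ℚ ≤ Bsphere d q) × (Bsphere d q ≡ 1ℚ ⇔ d ≡ 1)
  sphere 1 q@(suc _) _ _ = ≤-reflexive (sym (Bsphere-1 q)) , mk⇔ (λ _ → refl) (λ _ → Bsphere-1 q)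
  sphere (suc (suc e)) q _ 2≤q =
    <⇒≤ (1<Bsphere e q 2≤q) , mk⇔ (λ B≡1 → ⊥-elim (<⇒≢ (1<Bsphere e q 2≤q) (sym B≡1))) (λ ())
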